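{- Let $n\ge2$ and let $T=(T_a,T_b)$ be a rooted binary tree with $n$ leaves and minimal Colless index, i.e. $\mathcal{C}(T)=c_n$, where $T_a,T_b$ have $n_a\ge n_b$ leaves. Then $$n_a^{gfb}\ge n_a\ge n_a^{mb},\qquad n_b^{gfb}\le n_b\le n_b^{mb},$$ where $n_a^{gfb}\ge n_b^{gfb}$ are the leaf numbers of the two root subtrees of the GFB tree $T^{gfb}_n$ and $n_a^{mb}\ge n_b^{mb}$ are those of the maximally balanced tree $T^{mb}_n$.
   Context: A rooted binary tree with $n\ge2$ leaves is a rooted tree in which the root has degree 2 and every other internal vertex has degree 3 (each internal vertex has exactly two children); the single vertex is the rooted binary tree with one leaf. $T=(T_a,T_b)$ denotes the decomposition into the subtrees rooted at the two children of the root. For a vertex $v$, $\kappa_T(v)$ is the number of leaves descending from $v$. For an internal vertex $v$ with children $v_1,v_2$, $bal_T(v)=|\kappa_T(v_1)-\kappa_T(v_2)|$, the Colless index is $\mathcal{C}(T)=\sum_{v\text{ internal}} bal_T(v)$, and $c_n$ is its minimum over rooted binary trees with $n$ leaves. $T^{mb}_n$ is the unique rooted binary tree with $n$ leaves with $bal(v)\le1$ for all internal $v$ (root split $\lceil n/2\rceil,\lfloor n/2\rfloor$). The GFB tree $T^{gfb}_n$ is the output (up to isomorphism) of the algorithm: start with $n$ single-vertex trees; while more than one tree remains, remove a tree $u$ with minimum number of leaves, then a tree $v$ with minimum number of leaves among the remaining, and add the tree with a new root whose children are the roots of $u$ and $v$. -}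

module Defs where

open import Data.Nat using (ℕ; zero; suc; _+_; _≤_; _≤ᵇ_; _⊔_; _⊓_; ∣_-_∣; ⌊_/2⌋; ⌈_/2⌉)
open import Data.List using (List; []; _∷_; replicate)
open import Data.Bool using (if_then_else_)

data Tree : Set where
  leaf : Tree
  node : Tree → Tree → Tree

leaves : Tree → ℕ
leaves leaf       = 1
leaves (node l r) = leaves l + leaves r

colless : Tree → ℕ
colless leaf       = 0
colless (node l r) = ∣ leaves l - leaves r ∣ + colless l + colless r

MinColless : Tree → Set
MinColless T = ∀ (T' : Tree) → leaves T' ≡' leaves T → colless T ≤ colless T'
  where open import Relation.Binary.PropositionalEquality renaming (_≡_ to _≡'_)

-- Maximally balanced tree: root split ⌈n/2⌉, ⌊n/2⌋, recursively.
-- The first argument is fuel (n suffices since sizes halve).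
mbF : ℕ → ℕ → Tree
mbF zero    n             = leaf
mbF (suc k) zero          = leaf
mbF (suc k) (suc zero)    = leaf
mbF (suc k) n@(suc (suc _)) = node (mbF k ⌈ n /2⌉) (mbF k ⌊ n /2⌋)

mb : ℕ → Tree
mb n = mbF n n

-- The forest is kept as a list sorted by number of leaves
-- (nondecreasing); the first two entries are then a tree u of minimum leaf
-- number and a tree v of minimum leaf number among the rest.
insertT : Tree → List Tree → List Tree
insertT t []       = t ∷ []
insertT t (s ∷ ss) = if leaves t ≤ᵇ leaves s then t ∷ s ∷ ss else s ∷ insertT t ss

-- first argument is fuel (n merges suffice for n initial trees)
gfbLoop : ℕ → List Tree → Tree
gfbLoop _       []           = leaf
gfbLoop _       (t ∷ [])     = t
gfbLoop zero    (t ∷ _ ∷ _)  = t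
gfbLoop (suc k) (u ∷ v ∷ ts) = gfbLoop k (insertT (node u v) ts)

gfb : ℕ → Tree
gfb n = gfbLoop n (replicate n leaf)

rootA : Tree → ℕ
rootA leaf       = 0
rootA (node l r) = leaves l ⊔ leaves r

rootB : Tree → ℕ
rootB leaf       = 0
rootB (node l r) = leaves l ⊓ leaves r

{-# OPTIONS --safe #-}
-- Write cmb n for the Colless index of the maximally balanced tree on n leaves, so that
-- cmb (2m) = 2 cmb m and cmb (2m+1) = 1 + cmb (m+1) + cmb m (m ≥ 1). For 1 ≤ b ≤ a, induction on
-- a + b with a case split on the parities of a and b gives cmb (a+b) ≤ cmb a + cmb b + (a − b),
-- strictly when a exceeds the larger root part of the GFB tree on a + b leaves; that part is
-- additive over the halves of a + b, so strictness always passes to one of the halves.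
-- Hence cmb n is the minimal Colless index, and a minimal tree (Ta, Tb) satisfies
-- cmb a + cmb b + (a − b) ≤ cmb (a + b), so a cannot exceed the GFB split. The split itself comes
-- from the invariant of the GFB algorithm: between two doublings of a power of two c, the sorted
-- forest consists of trees with c leaves, at most one tree with strictly between c and 2c
-- leaves, and trees with 2c leaves.
module Submission where

open import Defs
open import Data.Nat
open import Data.Nat.Properties
open import Data.Nat.Tactic.RingSolver using (solve-∀)
open import Data.Product using (∃-syntax; _×_; _,_; proj₁; proj₂)
open import Data.Sum using (_⊎_; inj₁; inj₂; [_,_]′; map)
open import Data.Empty using (⊥-elim)
open import Data.Bool using (true; false; T)
open import Data.List using (List; []; _∷_; replicate; length)
open import Data.List.Properties using (length-replicate)
open import Data.List.Relation.Unary.All using (All; []; _∷_)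
open import Function using (_∘_)
open import Relation.Nullary using (¬_; yes; no)
open import Relation.Binary.PropositionalEquality

double-cancel-≤ : ∀ {x y} → x + x ≤ y + y → x ≤ y
double-cancel-≤ h = ≮⇒≥ λ y<x → <⇒≱ (+-mono-< y<x y<x) h

double-cancel-< : ∀ {x y} → x + x < y + y → x < y
double-cancel-< h = ≰⇒> λ y≤x → <⇒≱ h (+-mono-≤ y≤x y≤x)

double≤odd⇒≤ : ∀ {x y} → x + x ≤ suc (y + y) → x ≤ y
double≤odd⇒≤ {y = y} h =
  ≤-pred (double-cancel-< (≤-trans (s≤s h) (≤-reflexive (cong suc (sym (+-suc y y))))))

1≤double⇒1≤ : ∀ {x} → 1 ≤ x + x → 1 ≤ x
1≤double⇒1≤ {suc _} _ = s≤s z≤n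

∣m-n∣+n≡m : ∀ {m n} → n ≤ m → ∣ m - n ∣ + n ≡ m
∣m-n∣+n≡m n≤m = trans (cong (_+ _) (m≤n⇒∣n-m∣≡n∸m n≤m)) (m∸n+n≡m n≤m)

m⊓n+m⊔n≡m+n : ∀ m n → m ⊓ n + (m ⊔ n) ≡ m + n
m⊓n+m⊔n≡m+n m n with ≤-total m n
... | inj₁ m≤n = cong₂ _+_ (m≤n⇒m⊓n≡m m≤n) (m≤n⇒m⊔n≡n m≤n)
... | inj₂ n≤m = trans (cong₂ _+_ (m≥n⇒m⊓n≡n n≤m) (m≥n⇒m⊔n≡m n≤m)) (+-comm n m)

⌈m+n/2⌉≤m : ∀ {m n} → n ≤ m → ⌈ m + n /2⌉ ≤ m
⌈m+n/2⌉≤m {m} n≤m = ≤-trans (⌈n/2⌉-mono (+-monoʳ-≤ m n≤m)) (≤-reflexive (sym (n≡⌈n+n/2⌉ m)))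

n≤⌊m+n/2⌋ : ∀ {m n} → n ≤ m → n ≤ ⌊ m + n /2⌋
n≤⌊m+n/2⌋ {n = n} n≤m = ≤-trans (≤-reflexive (n≡⌊n+n/2⌋ n)) (⌊n/2⌋-mono (+-monoˡ-≤ n n≤m))

double-distrib : ∀ a b → a + a + (b + b) ≡ (a + b) + (a + b)
double-distrib = solve-∀

data EvenOdd : ℕ → Set where
  even : ∀ p → EvenOdd (p + p)
  odd  : ∀ p → EvenOdd (suc (p + p))

evenOdd : ∀ n → EvenOdd n
evenOdd zero = even zero
evenOdd (suc n) with evenOdd n
... | even p = odd p
... | odd p  = subst EvenOdd (cong suc (+-suc p p)) (even (suc p))

-- The maximally balanced tree

mbF-fuel : ∀ {k k′} n → n ≤ k → n ≤ k′ → mbF k n ≡ mbF k′ n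
mbF-fuel {zero}  {zero}  zero _ _ = refl
mbF-fuel {zero}  {suc _} zero _ _ = refl
mbF-fuel {suc _} {zero}  zero _ _ = refl
mbF-fuel {suc _} {suc _} zero _ _ = refl
mbF-fuel {suc _} {suc _} (suc zero) _ _ = refl
mbF-fuel {suc _} {suc _} (suc (suc m)) (s≤s n≤k) (s≤s n≤k′) =
  cong₂ node (mbF-fuel _ (≤-trans (s≤s (⌈n/2⌉≤n m)) n≤k) (≤-trans (s≤s (⌈n/2⌉≤n m)) n≤k′))
             (mbF-fuel _ (≤-trans (s≤s (⌊n/2⌋≤n m)) n≤k) (≤-trans (s≤s (⌊n/2⌋≤n m)) n≤k′))

mb-node : ∀ n → 2 ≤ n → mb n ≡ node (mb ⌈ n /2⌉) (mb ⌊ n /2⌋)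
mb-node (suc zero) (s≤s ())
mb-node (suc (suc m)) _ = cong₂ node (mbF-fuel _ (s≤s (⌈n/2⌉≤n m)) ≤-refl)
                                     (mbF-fuel _ (s≤s (⌊n/2⌋≤n m)) ≤-refl)

leaves-mbF : ∀ k n → 1 ≤ n → n ≤ k → leaves (mbF k n) ≡ n
leaves-mbF (suc k) (suc zero) _ _ = refl
leaves-mbF (suc k) n@(suc (suc m)) _ (s≤s n≤k) =
  trans (cong₂ _+_ (leaves-mbF k _ (s≤s z≤n) (≤-trans (s≤s (⌈n/2⌉≤n m)) n≤k))
                   (leaves-mbF k _ (s≤s z≤n) (≤-trans (s≤s (⌊n/2⌋≤n m)) n≤k)))
        (trans (+-comm ⌈ n /2⌉ ⌊ n /2⌋) (⌊n/2⌋+⌈n/2⌉≡n n))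

leaves-mb : ∀ n → 1 ≤ n → leaves (mb n) ≡ n
leaves-mb n 1≤n = leaves-mbF n n 1≤n ≤-refl

leaves-mb-halves : ∀ n → 2 ≤ n → leaves (mb ⌈ n /2⌉) ≡ ⌈ n /2⌉ × leaves (mb ⌊ n /2⌋) ≡ ⌊ n /2⌋
leaves-mb-halves (suc zero) (s≤s ())
leaves-mb-halves (suc (suc m)) _ = leaves-mb _ (s≤s z≤n) , leaves-mb _ (s≤s z≤n)

mb-rootA : ∀ n → 2 ≤ n → rootA (mb n) ≡ ⌈ n /2⌉
mb-rootA n 2≤n rewrite mb-node n 2≤n | proj₁ (leaves-mb-halves n 2≤n) | proj₂ (leaves-mb-halves n 2≤n) =
  m≥n⇒m⊔n≡m (⌊n/2⌋≤⌈n/2⌉ n)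

mb-rootB : ∀ n → 2 ≤ n → rootB (mb n) ≡ ⌊ n /2⌋
mb-rootB n 2≤n rewrite mb-node n 2≤n | proj₁ (leaves-mb-halves n 2≤n) | proj₂ (leaves-mb-halves n 2≤n) =
  m≥n⇒m⊓n≡n (⌊n/2⌋≤⌈n/2⌉ n)

cmb : ℕ → ℕ
cmb n = colless (mb n)

cmb-node : ∀ n → 2 ≤ n → cmb n ≡ ∣ ⌈ n /2⌉ - ⌊ n /2⌋ ∣ + cmb ⌈ n /2⌉ + cmb ⌊ n /2⌋
cmb-node n 2≤n rewrite mb-node n 2≤n | proj₁ (leaves-mb-halves n 2≤n) | proj₂ (leaves-mb-halves n 2≤n) = refl

cmb-double : ∀ m → cmb (m + m) ≡ cmb m + cmb m
cmb-double zero = refl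
cmb-double m@(suc _) = begin
  cmb (m + m)
    ≡⟨ cmb-node (m + m) (+-mono-≤ (s≤s z≤n) (s≤s z≤n)) ⟩
  ∣ ⌈ m + m /2⌉ - ⌊ m + m /2⌋ ∣ + cmb ⌈ m + m /2⌉ + cmb ⌊ m + m /2⌋
    ≡⟨ cong₂ (λ x y → ∣ x - y ∣ + cmb x + cmb y) (sym (n≡⌈n+n/2⌉ m)) (sym (n≡⌊n+n/2⌋ m)) ⟩
  ∣ m - m ∣ + cmb m + cmb m
    ≡⟨ cong (λ d → d + cmb m + cmb m) (∣n-n∣≡0 m) ⟩
  cmb m + cmb m
    ∎
  where open ≡-Reasoning

cmb-odd : ∀ m → 1 ≤ m → cmb (suc (m + m)) ≡ suc (cmb (suc m) + cmb m)
cmb-odd m 1≤m = begin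
  cmb (suc (m + m))
    ≡⟨ cmb-node (suc (m + m)) (s≤s (≤-trans 1≤m (m≤m+n m m))) ⟩
  ∣ suc ⌊ m + m /2⌋ - ⌈ m + m /2⌉ ∣ + cmb (suc ⌊ m + m /2⌋) + cmb ⌈ m + m /2⌉
    ≡⟨ cong₂ (λ x y → ∣ suc x - y ∣ + cmb (suc x) + cmb y) (sym (n≡⌊n+n/2⌋ m)) (sym (n≡⌈n+n/2⌉ m)) ⟩
  ∣ suc m - m ∣ + cmb (suc m) + cmb m
    ≡⟨ cong (λ d → d + cmb (suc m) + cmb m) ∣1+m-m∣≡1 ⟩
  suc (cmb (suc m) + cmb m)
    ∎
  where
  open ≡-Reasoning
  ∣1+m-m∣≡1 : ∣ suc m - m ∣ ≡ 1
  ∣1+m-m∣≡1 = trans (m≤n⇒∣n-m∣≡n∸m (n≤1+n m)) (m+n∸n≡m 1 m)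

LeStrictIf : Set → ℕ → ℕ → Set
LeStrictIf H x y = x ≤ y × (H → x < y)

LeStrictIf-resp : ∀ {H x x′ y y′} → x ≡ x′ → y ≡ y′ → LeStrictIf H x′ y′ → LeStrictIf H x y
LeStrictIf-resp refl refl b = b

LeStrictIf-< : ∀ {H x y} → x < y → LeStrictIf H x y
LeStrictIf-< x<y = <⇒≤ x<y , λ _ → x<y

LeStrictIf-suc : ∀ {H x y} → LeStrictIf H x y → LeStrictIf H (suc x) (suc y)
LeStrictIf-suc (x≤y , x<y) = s≤s x≤y , s≤s ∘ x<y

LeStrictIf-+ : ∀ {H H₁ H₂ : Set} {x₁ x₂ y₁ y₂} →
  LeStrictIf H₁ x₁ y₁ → LeStrictIf H₂ x₂ y₂ → (H → H₁ ⊎ H₂) → LeStrictIf H (x₁ + x₂) (y₁ + y₂)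
LeStrictIf-+ (≤₁ , <₁) (≤₂ , <₂) split =
  +-mono-≤ ≤₁ ≤₂ ,
  λ h → [ (λ h₁ → +-mono-<-≤ (<₁ h₁) ≤₂) , (λ h₂ → +-mono-≤-< ≤₁ (<₂ h₂)) ]′ (split h)

LeStrictIf-cancelʳ : ∀ {H x y} k → LeStrictIf H (x + k) (y + k) → LeStrictIf H x y
LeStrictIf-cancelʳ k (≤′ , <′) = +-cancelʳ-≤ k _ _ ≤′ , +-cancelʳ-< k _ _ ∘ <′

-- The root split of the GFB tree

data Pow2 : ℕ → Set where
  one    : Pow2 1
  double : ∀ {w} → Pow2 w → Pow2 (w + w)

Pow2⇒1≤ : ∀ {w} → Pow2 w → 1 ≤ w
Pow2⇒1≤ one = ≤-refl
Pow2⇒1≤ (double {w} pw) = ≤-trans (Pow2⇒1≤ pw) (m≤m+n w w)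

Window : ℕ → ℕ → Set
Window w n = Pow2 w × w + w ≤ n × n ≤ (w + w) + (w + w)

-- For a window w of n, the larger root subtree of the GFB tree on n leaves has (n ∸ w) ⊓ 2w
-- leaves (for n = 4w both windows w and 2w give 2w).
ExceedsAt : ℕ → ℕ → ℕ → Set
ExceedsAt w n a = n < a + w ⊎ w + w < a

ExceedsGfbSplit : ℕ → ℕ → Set
ExceedsGfbSplit n a = ∃[ w ] Window w n × ExceedsAt w n a

-- Under the halved window, the GFB split of n₁ + n₂ is the sum of those of n₁ and n₂.
exceedsAt-split : ∀ {C n₁ n₂ x y} →
  ExceedsAt (C + C) (n₁ + n₂) (x + y) → ExceedsAt C n₁ x ⊎ ExceedsAt C n₂ y
exceedsAt-split {C} {n₁} {n₂} {x} {y} (inj₁ n<) with n₁ <? x + C | n₂ <? y + C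
... | yes n₁< | _       = inj₁ (inj₁ n₁<)
... | no _    | yes n₂< = inj₂ (inj₁ n₂<)
... | no n₁≮  | no n₂≮  = ⊥-elim (<⇒≱ n< (begin
  x + y + (C + C)   ≡⟨ interchange x y C ⟩
  (x + C) + (y + C) ≤⟨ +-mono-≤ (≮⇒≥ n₁≮) (≮⇒≥ n₂≮) ⟩
  n₁ + n₂           ∎))
  where
  open ≤-Reasoning
  interchange : ∀ x y C → x + y + (C + C) ≡ (x + C) + (y + C)
  interchange = solve-∀
exceedsAt-split {C} {x = x} {y} (inj₂ 4C<) with C + C <? x | C + C <? y
... | yes 2C<x | _        = inj₁ (inj₂ 2C<x)
... | no _     | yes 2C<y = inj₂ (inj₂ 2C<y)
... | no x≯    | no y≯    = ⊥-elim (<⇒≱ 4C< (+-mono-≤ (≮⇒≥ x≯) (≮⇒≥ y≯)))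

exceeds-even-halves : ∀ {m x y} → 3 ≤ m →
  ExceedsGfbSplit (m + m) (x + y) → ExceedsGfbSplit m x ⊎ ExceedsGfbSplit m y
exceeds-even-halves 3≤m (_ , (one , _ , 2m≤4) , _) = ⊥-elim (<⇒≱ (+-mono-< 3≤m 3≤m) 2m≤4)
exceeds-even-halves {m} {x} {y} _ (_ , (double {C} pC , 4C≤2m , 2m≤8C) , ex) =
  map (λ e → C , window , e) (λ e → C , window , e) (exceedsAt-split {C} {m} {m} {x} {y} ex)
  where
  window : Window C m
  window = pC , double-cancel-≤ 4C≤2m , double-cancel-≤ 2m≤8C

exceeds-odd-halves : ∀ {m x y} → 2 ≤ m →
  ExceedsGfbSplit (suc (m + m)) (x + y) → ExceedsGfbSplit (suc m) x ⊎ ExceedsGfbSplit m y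
exceeds-odd-halves 2≤m (_ , (one , _ , 2m+1≤4) , _) = ⊥-elim (<⇒≱ (s≤s (+-mono-≤ 2≤m 2≤m)) 2m+1≤4)
exceeds-odd-halves {m} {x} {y} _ (_ , (double {C} pC , 4C≤2m+1 , 2m+1≤8C) , ex) =
  map (λ e → C , upper , e) (λ e → C , lower , e) (exceedsAt-split {C} {suc m} {m} {x} {y} ex)
  where
  2C≤m : C + C ≤ m
  2C≤m = double≤odd⇒≤ 4C≤2m+1
  m<4C : m < (C + C) + (C + C)
  m<4C = double-cancel-< 2m+1≤8C
  upper : Window C (suc m)
  upper = pC , m≤n⇒m≤1+n 2C≤m , m<4C
  lower : Window C m
  lower = pC , 2C≤m , <⇒≤ m<4C

¬exceeds-half : ∀ a → ¬ ExceedsGfbSplit (a + a) a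
¬exceeds-half a (w , (_ , 2w≤2a , _) , inj₁ 2a<a+w) =
  <⇒≱ (+-cancelˡ-< a a w 2a<a+w) (double-cancel-≤ 2w≤2a)
¬exceeds-half a (w , (_ , _ , 2a≤4w) , inj₂ 2w<a) = <⇒≱ 2w<a (double-cancel-≤ 2a≤4w)

exceeds-odd⇒2≤p : ∀ p → ExceedsGfbSplit (suc (p + p)) (p + p) → 2 ≤ p
exceeds-odd⇒2≤p zero (_ , (pw , 2w≤1 , _) , _) =
  ⊥-elim (<⇒≱ (s≤s ≤-refl) (≤-trans (+-mono-≤ (Pow2⇒1≤ pw) (Pow2⇒1≤ pw)) 2w≤1))
exceeds-odd⇒2≤p (suc zero) (_ , (one , _) , inj₁ (s≤s (s≤s (s≤s ()))))
exceeds-odd⇒2≤p (suc zero) (_ , (one , _) , inj₂ (s≤s (s≤s ())))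
exceeds-odd⇒2≤p (suc zero) (_ , (double {C} pC , 4C≤3 , _) , _) =
  ⊥-elim (<⇒≱ (n<1+n 3) (≤-trans (+-mono-≤ 2≤2C 2≤2C) 4C≤3))
  where
  2≤2C : 2 ≤ C + C
  2≤2C = +-mono-≤ (Pow2⇒1≤ pC) (Pow2⇒1≤ pC)
exceeds-odd⇒2≤p (suc (suc p)) _ = s≤s (s≤s z≤n)

-- The Colless index of a root split

-- cmb (a + b) ≤ cmb a + cmb b + (a − b), strictly when a exceeds the GFB split, with b moved
-- across so that no truncated subtraction occurs.
SplitBoundAt : ℕ → ℕ → ℕ → Set
SplitBoundAt n a b = LeStrictIf (ExceedsGfbSplit n a) (cmb n + b) (cmb a + cmb b + a)

SplitBound : ℕ → ℕ → Set
SplitBound a b = SplitBoundAt (a + b) a b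

SplitBoundBelow : ℕ → Set
SplitBoundBelow n = ∀ a b → a + b < n → 1 ≤ b → b ≤ a → SplitBound a b

SplitBoundBelow⇒At : ∀ {n k} → SplitBoundBelow n → ∀ a b → a + b ≡ k → k < n → 1 ≤ b → b ≤ a →
  SplitBoundAt k a b
SplitBoundBelow⇒At IH a b refl = IH a b

split-bound-diagonal : ∀ a → SplitBound a a
split-bound-diagonal a = ≤-reflexive (cong (_+ a) (cmb-double a)) , ⊥-elim ∘ ¬exceeds-half a

even-even : ∀ p q → SplitBoundBelow (p + p + (q + q)) → 1 ≤ q → q < p → SplitBound (p + p) (q + q)
even-even p q IH 1≤q q<p = LeStrictIf-resp lhs rhs (LeStrictIf-+ half half split)
  where
  open ≡-Reasoning
  m : ℕ
  m = p + q
  sum≡ : p + p + (q + q) ≡ m + m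
  sum≡ = double-distrib p q
  half : SplitBound p q
  half = subst SplitBoundBelow sum≡ IH p q (m<m+n m (≤-trans 1≤q (m≤n+m q p))) 1≤q (<⇒≤ q<p)
  split : ExceedsGfbSplit (p + p + (q + q)) (p + p) → ExceedsGfbSplit m p ⊎ ExceedsGfbSplit m p
  split = exceeds-even-halves (+-mono-≤ (≤-trans (s≤s 1≤q) q<p) 1≤q)
        ∘ subst (λ n → ExceedsGfbSplit n (p + p)) sum≡
  lhs : cmb (p + p + (q + q)) + (q + q) ≡ (cmb m + q) + (cmb m + q)
  lhs = begin
    cmb (p + p + (q + q)) + (q + q) ≡⟨ cong (λ n → cmb n + (q + q)) sum≡ ⟩
    cmb (m + m) + (q + q)           ≡⟨ cong (_+ (q + q)) (cmb-double m) ⟩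
    cmb m + cmb m + (q + q)         ≡⟨ double-distrib (cmb m) q ⟩
    (cmb m + q) + (cmb m + q)       ∎
  regroup : ∀ P Q p → P + P + (Q + Q) + (p + p) ≡ (P + Q + p) + (P + Q + p)
  regroup = solve-∀
  rhs : cmb (p + p) + cmb (q + q) + (p + p) ≡ (cmb p + cmb q + p) + (cmb p + cmb q + p)
  rhs = trans (cong₂ (λ x y → x + y + (p + p)) (cmb-double p) (cmb-double q))
              (regroup (cmb p) (cmb q) p)

odd-even : ∀ p q → SplitBoundBelow (suc (p + p) + (q + q)) → 1 ≤ q → q ≤ p →
  SplitBound (suc (p + p)) (q + q)
odd-even p q IH 1≤q q≤p = LeStrictIf-resp lhs rhs (LeStrictIf-suc (LeStrictIf-+ upper lower split))
  where
  open ≡-Reasoning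
  m : ℕ
  m = p + q
  1≤m : 1 ≤ m
  1≤m = ≤-trans 1≤q (m≤n+m q p)
  sum≡ : suc (p + p) + (q + q) ≡ suc (m + m)
  sum≡ = cong suc (double-distrib p q)
  IH′ : SplitBoundBelow (suc (m + m))
  IH′ = subst SplitBoundBelow sum≡ IH
  upper : SplitBound (suc p) q
  upper = IH′ (suc p) q (s≤s (m<m+n m 1≤m)) 1≤q (m≤n⇒m≤1+n q≤p)
  lower : SplitBound p q
  lower = IH′ p q (s≤s (m≤m+n m m)) 1≤q q≤p
  split : ExceedsGfbSplit (suc (p + p) + (q + q)) (suc (p + p)) →
    ExceedsGfbSplit (suc m) (suc p) ⊎ ExceedsGfbSplit m p
  split = exceeds-odd-halves (+-mono-≤ (≤-trans 1≤q q≤p) 1≤q)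
        ∘ subst (λ n → ExceedsGfbSplit n (suc p + p)) sum≡
  regroupˡ : ∀ A B q → suc (A + B) + (q + q) ≡ suc ((A + q) + (B + q))
  regroupˡ = solve-∀
  lhs : cmb (suc (p + p) + (q + q)) + (q + q) ≡ suc ((cmb (suc m) + q) + (cmb m + q))
  lhs = begin
    cmb (suc (p + p) + (q + q)) + (q + q) ≡⟨ cong (λ n → cmb n + (q + q)) sum≡ ⟩
    cmb (suc (m + m)) + (q + q)           ≡⟨ cong (_+ (q + q)) (cmb-odd m 1≤m) ⟩
    suc (cmb (suc m) + cmb m) + (q + q)   ≡⟨ regroupˡ (cmb (suc m)) (cmb m) q ⟩
    suc ((cmb (suc m) + q) + (cmb m + q)) ∎
  regroupʳ : ∀ P₁ P₀ Q p →
    suc (P₁ + P₀) + (Q + Q) + suc (p + p) ≡ suc ((P₁ + Q + suc p) + (P₀ + Q + p))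
  regroupʳ = solve-∀
  rhs : cmb (suc (p + p)) + cmb (q + q) + suc (p + p)
      ≡ suc ((cmb (suc p) + cmb q + suc p) + (cmb p + cmb q + p))
  rhs = trans (cong₂ (λ x y → x + y + suc (p + p)) (cmb-odd p (≤-trans 1≤q q≤p)) (cmb-double q))
              (regroupʳ (cmb (suc p)) (cmb p) (cmb q) p)

even-odd : ∀ p q → SplitBoundBelow (p + p + suc (q + q)) → 1 ≤ q → q < p →
  SplitBound (p + p) (suc (q + q))
even-odd p q IH 1≤q q<p = LeStrictIf-resp lhs rhs (LeStrictIf-suc (LeStrictIf-+ upper lower split))
  where
  open ≡-Reasoning
  m : ℕ
  m = p + q
  1≤m : 1 ≤ m
  1≤m = ≤-trans 1≤q (m≤n+m q p)
  sum≡ : p + p + suc (q + q) ≡ suc (m + m)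
  sum≡ = trans (+-suc (p + p) (q + q)) (cong suc (double-distrib p q))
  IH′ : SplitBoundBelow (suc (m + m))
  IH′ = subst SplitBoundBelow sum≡ IH
  upper : SplitBoundAt (suc m) p (suc q)
  upper = SplitBoundBelow⇒At IH′ p (suc q) (+-suc p q) (s≤s (m<m+n m 1≤m)) (s≤s z≤n) q<p
  lower : SplitBound p q
  lower = IH′ p q (s≤s (m≤m+n m m)) 1≤q (<⇒≤ q<p)
  split : ExceedsGfbSplit (p + p + suc (q + q)) (p + p) → ExceedsGfbSplit (suc m) p ⊎ ExceedsGfbSplit m p
  split = exceeds-odd-halves (+-mono-≤ (≤-trans 1≤q (<⇒≤ q<p)) 1≤q)
        ∘ subst (λ n → ExceedsGfbSplit n (p + p)) sum≡
  regroupˡ : ∀ A B q → suc (A + B) + suc (q + q) ≡ suc ((A + suc q) + (B + q))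
  regroupˡ = solve-∀
  lhs : cmb (p + p + suc (q + q)) + suc (q + q) ≡ suc ((cmb (suc m) + suc q) + (cmb m + q))
  lhs = begin
    cmb (p + p + suc (q + q)) + suc (q + q)   ≡⟨ cong (λ n → cmb n + suc (q + q)) sum≡ ⟩
    cmb (suc (m + m)) + suc (q + q)           ≡⟨ cong (_+ suc (q + q)) (cmb-odd m 1≤m) ⟩
    suc (cmb (suc m) + cmb m) + suc (q + q)   ≡⟨ regroupˡ (cmb (suc m)) (cmb m) q ⟩
    suc ((cmb (suc m) + suc q) + (cmb m + q)) ∎
  regroupʳ : ∀ P Q₁ Q₀ p → P + P + suc (Q₁ + Q₀) + (p + p) ≡ suc ((P + Q₁ + p) + (P + Q₀ + p))
  regroupʳ = solve-∀
  rhs : cmb (p + p) + cmb (suc (q + q)) + (p + p)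
      ≡ suc ((cmb p + cmb (suc q) + p) + (cmb p + cmb q + p))
  rhs = trans (cong₂ (λ x y → x + y + (p + p)) (cmb-double p) (cmb-odd q 1≤q))
              (regroupʳ (cmb p) (cmb (suc q)) (cmb q) p)

-- b = 1 needs its own cases since cmb 1 = 0 falls outside the odd recursion for cmb.
even-one : ∀ p → SplitBoundBelow (p + p + 1) → 1 ≤ p → SplitBound (p + p) 1
even-one p IH 1≤p = LeStrictIf-resp lhs rhs (LeStrictIf-+ upper tail split)
  where
  sum≡ : p + p + 1 ≡ suc (p + p)
  sum≡ = +-comm (p + p) 1
  upper : SplitBoundAt (suc p) p 1
  upper = SplitBoundBelow⇒At IH p 1 (+-comm p 1) (subst (suc p <_) (sym sum≡) (s≤s (m<m+n p 1≤p)))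
                             ≤-refl 1≤p
  tail : LeStrictIf (2 ≤ p) (cmb p + 1) (cmb p + p)
  tail = +-monoʳ-≤ (cmb p) 1≤p , +-monoʳ-< (cmb p)
  split : ExceedsGfbSplit (p + p + 1) (p + p) → ExceedsGfbSplit (suc p) p ⊎ 2 ≤ p
  split = inj₂ ∘ exceeds-odd⇒2≤p p ∘ subst (λ n → ExceedsGfbSplit n (p + p)) sum≡
  regroupˡ : ∀ A B → suc (A + B) + 1 ≡ (A + 1) + (B + 1)
  regroupˡ = solve-∀
  lhs : cmb (p + p + 1) + 1 ≡ (cmb (suc p) + 1) + (cmb p + 1)
  lhs = trans (cong (λ n → cmb n + 1) sum≡)
              (trans (cong (_+ 1) (cmb-odd p 1≤p)) (regroupˡ (cmb (suc p)) (cmb p)))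
  regroupʳ : ∀ P p → P + P + 0 + (p + p) ≡ (P + 0 + p) + (P + p)
  regroupʳ = solve-∀
  rhs : cmb (p + p) + cmb 1 + (p + p) ≡ (cmb p + cmb 1 + p) + (cmb p + p)
  rhs = trans (cong (λ x → x + 0 + (p + p)) (cmb-double p)) (regroupʳ (cmb p) p)

odd-one : ∀ p → SplitBoundBelow (suc (p + p) + 1) → 1 ≤ p → SplitBound (suc (p + p)) 1
odd-one p IH 1≤p = LeStrictIf-< (begin-strict
  cmb (suc (p + p) + 1) + 1                   ≡⟨ lhs ⟩
  cmb (suc p) + (cmb (suc p) + 1)             ≤⟨ +-monoʳ-≤ (cmb (suc p)) (proj₁ upper) ⟩
  cmb (suc p) + (cmb p + 0 + p)               <⟨ m<m+n _ (s≤s z≤n) ⟩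
  cmb (suc p) + (cmb p + 0 + p) + suc (suc p) ≡⟨ rhs ⟩
  cmb (suc (p + p)) + cmb 1 + suc (p + p)     ∎)
  where
  open ≤-Reasoning
  upper : SplitBoundAt (suc p) p 1
  upper = SplitBoundBelow⇒At IH p 1 (+-comm p 1) (<-≤-trans (s≤s (m<m+n p 1≤p)) (m≤m+n _ 1))
                             ≤-refl 1≤p
  sum≡ : ∀ p → suc (p + p) + 1 ≡ suc p + suc p
  sum≡ = solve-∀
  regroupˡ : ∀ A → A + A + 1 ≡ A + (A + 1)
  regroupˡ = solve-∀
  lhs : cmb (suc (p + p) + 1) + 1 ≡ cmb (suc p) + (cmb (suc p) + 1)
  lhs = trans (cong (λ n → cmb n + 1) (sum≡ p))
              (trans (cong (_+ 1) (cmb-double (suc p))) (regroupˡ (cmb (suc p))))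
  regroupʳ : ∀ A B p → A + (B + 0 + p) + suc (suc p) ≡ suc (A + B) + 0 + suc (p + p)
  regroupʳ = solve-∀
  rhs : cmb (suc p) + (cmb p + 0 + p) + suc (suc p) ≡ cmb (suc (p + p)) + cmb 1 + suc (p + p)
  rhs = trans (regroupʳ (cmb (suc p)) (cmb p) p)
              (cong (λ x → x + 0 + suc (p + p)) (sym (cmb-odd p 1≤p)))

odd-odd : ∀ p q → SplitBoundBelow (suc (p + p) + suc (q + q)) → 1 ≤ q → q < p →
  SplitBound (suc (p + p)) (suc (q + q))
odd-odd p q IH 1≤q q<p = LeStrictIf-< (begin-strict
  cmb (suc (p + p) + suc (q + q)) + suc (q + q)                 ≡⟨ lhs ⟩
  (cmb (suc m) + q) + (cmb (suc m) + suc q)                     ≤⟨ +-mono-≤ (proj₁ upper) (proj₁ lower) ⟩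
  (cmb (suc p) + cmb q + suc p) + (cmb p + cmb (suc q) + p)     <⟨ m<m+n _ (s≤s z≤n) ⟩
  (cmb (suc p) + cmb q + suc p) + (cmb p + cmb (suc q) + p) + 2 ≡⟨ rhs ⟩
  cmb (suc (p + p)) + cmb (suc (q + q)) + suc (p + p)           ∎)
  where
  open ≤-Reasoning
  m : ℕ
  m = p + q
  sum≡′ : ∀ p q → suc (p + p) + suc (q + q) ≡ suc (p + q) + suc (p + q)
  sum≡′ = solve-∀
  sum≡ : suc (p + p) + suc (q + q) ≡ suc m + suc m
  sum≡ = sum≡′ p q
  IH′ : SplitBoundBelow (suc m + suc m)
  IH′ = subst SplitBoundBelow sum≡ IH
  upper : SplitBound (suc p) q
  upper = IH′ (suc p) q (m<m+n (suc m) (s≤s z≤n)) 1≤q (m≤n⇒m≤1+n (<⇒≤ q<p))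
  lower : SplitBoundAt (suc m) p (suc q)
  lower = SplitBoundBelow⇒At IH′ p (suc q) (+-suc p q) (m<m+n (suc m) (s≤s z≤n)) (s≤s z≤n) q<p
  regroupˡ : ∀ A q → A + A + suc (q + q) ≡ (A + q) + (A + suc q)
  regroupˡ = solve-∀
  lhs : cmb (suc (p + p) + suc (q + q)) + suc (q + q) ≡ (cmb (suc m) + q) + (cmb (suc m) + suc q)
  lhs = trans (cong (λ n → cmb n + suc (q + q)) sum≡)
              (trans (cong (_+ suc (q + q)) (cmb-double (suc m))) (regroupˡ (cmb (suc m)) q))
  regroupʳ : ∀ P₁ P₀ Q₁ Q₀ p →
    (P₁ + Q₀ + suc p) + (P₀ + Q₁ + p) + 2 ≡ suc (P₁ + P₀) + suc (Q₁ + Q₀) + suc (p + p)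
  regroupʳ = solve-∀
  rhs : (cmb (suc p) + cmb q + suc p) + (cmb p + cmb (suc q) + p) + 2
      ≡ cmb (suc (p + p)) + cmb (suc (q + q)) + suc (p + p)
  rhs = trans (regroupʳ (cmb (suc p)) (cmb p) (cmb (suc q)) (cmb q) p)
              (sym (cong₂ (λ x y → x + y + suc (p + p)) (cmb-odd p (≤-trans 1≤q (<⇒≤ q<p)))
                                                       (cmb-odd q 1≤q)))

split-bound-step : ∀ a b → SplitBoundBelow (a + b) → 1 ≤ b → b ≤ a → SplitBound a b
split-bound-step a b IH 1≤b b≤a with m≤n⇒m<n∨m≡n b≤a
... | inj₂ refl = split-bound-diagonal a
... | inj₁ b<a with evenOdd a | evenOdd b
...   | even p | even q       = even-even p q IH (1≤double⇒1≤ 1≤b) (double-cancel-< b<a)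
...   | odd p  | even q       = odd-even p q IH (1≤double⇒1≤ 1≤b) (double-cancel-≤ (≤-pred b<a))
...   | even p | odd zero     = even-one p IH (double-cancel-≤ b<a)
...   | even p | odd (suc q)  = even-odd p (suc q) IH (s≤s z≤n) (double-cancel-< (<⇒≤ b<a))
...   | odd p  | odd zero     = odd-one p IH (1≤double⇒1≤ (≤-pred b<a))
...   | odd p  | odd (suc q)  = odd-odd p (suc q) IH (s≤s z≤n) (double-cancel-< (≤-pred b<a))

split-bound-below : ∀ n → SplitBoundBelow n
split-bound-below zero _ _ ()
split-bound-below (suc n) a b a+b<1+n 1≤b b≤a with m≤n⇒m<n∨m≡n (≤-pred a+b<1+n)
... | inj₁ a+b<n = split-bound-below n a b a+b<n 1≤b b≤a
... | inj₂ a+b≡n =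
  split-bound-step a b (subst SplitBoundBelow (sym a+b≡n) (split-bound-below n)) 1≤b b≤a

split-bound : ∀ {a b} → 1 ≤ b → b ≤ a →
  LeStrictIf (ExceedsGfbSplit (a + b) a) (cmb (a + b)) (∣ a - b ∣ + cmb a + cmb b)
split-bound {a} {b} 1≤b b≤a =
  LeStrictIf-cancelʳ b
    (LeStrictIf-resp refl regroup (split-bound-step a b (split-bound-below (a + b)) 1≤b b≤a))
  where
  regroup : ∣ a - b ∣ + cmb a + cmb b + b ≡ cmb a + cmb b + a
  regroup = begin
    ∣ a - b ∣ + cmb a + cmb b + b   ≡⟨ rearrange ∣ a - b ∣ (cmb a) (cmb b) b ⟩
    cmb a + cmb b + (∣ a - b ∣ + b) ≡⟨ cong (cmb a + cmb b +_) (∣m-n∣+n≡m b≤a) ⟩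
    cmb a + cmb b + a               ∎
    where
    open ≡-Reasoning
    rearrange : ∀ d x y b → d + x + y + b ≡ x + y + (d + b)
    rearrange = solve-∀

1≤leaves : ∀ T → 1 ≤ leaves T
1≤leaves leaf       = ≤-refl
1≤leaves (node l r) = ≤-trans (1≤leaves l) (m≤m+n _ _)

cmb-node-≤ : ∀ a b → 1 ≤ a → 1 ≤ b → cmb (a + b) ≤ ∣ a - b ∣ + cmb a + cmb b
cmb-node-≤ a b 1≤a 1≤b with ≤-total b a
... | inj₁ b≤a = proj₁ (split-bound 1≤b b≤a)
... | inj₂ a≤b = begin
  cmb (a + b)                   ≡⟨ cong cmb (+-comm a b) ⟩
  cmb (b + a)                   ≤⟨ proj₁ (split-bound 1≤a a≤b) ⟩
  ∣ b - a ∣ + cmb b + cmb a     ≡⟨ cong₂ _+_ (cong₂ _+_ (∣-∣-comm b a) refl) refl ⟩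
  ∣ a - b ∣ + cmb b + cmb a     ≡⟨ +-assoc ∣ a - b ∣ (cmb b) (cmb a) ⟩
  ∣ a - b ∣ + (cmb b + cmb a)   ≡⟨ cong (∣ a - b ∣ +_) (+-comm (cmb b) (cmb a)) ⟩
  ∣ a - b ∣ + (cmb a + cmb b)   ≡⟨ sym (+-assoc ∣ a - b ∣ (cmb a) (cmb b)) ⟩
  ∣ a - b ∣ + cmb a + cmb b     ∎
  where open ≤-Reasoning

cmb-minimal : ∀ T → cmb (leaves T) ≤ colless T
cmb-minimal leaf       = z≤n
cmb-minimal (node l r) = ≤-trans (cmb-node-≤ (leaves l) (leaves r) (1≤leaves l) (1≤leaves r))
  (+-mono-≤ (+-monoʳ-≤ ∣ leaves l - leaves r ∣ (cmb-minimal l)) (cmb-minimal r))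

-- The GFB forest

HasLeaves : ℕ → Tree → Set
HasLeaves k t = leaves t ≡ k

data Stage (c : ℕ) : List Tree → Set where
  small∷  : ∀ {t ts} → leaves t ≡ c → Stage c ts → Stage c (t ∷ ts)
  middle∷ : ∀ {t ts} → c < leaves t → leaves t < c + c → All (HasLeaves (c + c)) ts →
            Stage c (t ∷ ts)
  doubled : ∀ {ts} → All (HasLeaves (c + c)) ts → Stage c ts

GfbForest : List Tree → Set
GfbForest ts = ∃[ c ] Pow2 c × Stage c ts

≤ᵇ≡true⇒≤ : ∀ {m n} → (m ≤ᵇ n) ≡ true → m ≤ n
≤ᵇ≡true⇒≤ {m} {n} eq = ≤ᵇ⇒≤ m n (subst T (sym eq) _)

insertT-All : ∀ {P : Tree → Set} {t} ts → P t → All P ts → All P (insertT t ts)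
insertT-All [] pt [] = pt ∷ []
insertT-All {t = t} (s ∷ ss) pt (ps ∷ pss) with leaves t ≤ᵇ leaves s
... | true  = pt ∷ ps ∷ pss
... | false = ps ∷ insertT-All ss pt pss

insert-doubled : ∀ {c t} ts → 1 ≤ c → leaves t ≡ c + c → Stage c ts → Stage c (insertT t ts)
insert-doubled [] _ lt (doubled []) = doubled (lt ∷ [])
insert-doubled {t = t} (s ∷ ss) 1≤c lt st with leaves t ≤ᵇ leaves s in le
insert-doubled {c} (s ∷ ss) 1≤c lt (small∷ ls _) | true =
  ⊥-elim (<⇒≱ (m<m+n c 1≤c) (subst₂ _≤_ lt ls (≤ᵇ≡true⇒≤ le)))
insert-doubled (s ∷ ss) 1≤c lt (middle∷ _ ls<2c _) | true =
  ⊥-elim (<⇒≱ ls<2c (subst (_≤ leaves s) lt (≤ᵇ≡true⇒≤ le)))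
insert-doubled (s ∷ ss) 1≤c lt (doubled all) | true = doubled (lt ∷ all)
insert-doubled (s ∷ ss) 1≤c lt (small∷ ls st) | false = small∷ ls (insert-doubled ss 1≤c lt st)
insert-doubled (s ∷ ss) 1≤c lt (middle∷ c< <2c all) | false = middle∷ c< <2c (insertT-All ss lt all)
insert-doubled (s ∷ ss) 1≤c lt (doubled (ls ∷ all)) | false = doubled (ls ∷ insertT-All ss lt all)

insert-middle : ∀ {c t} ts → c + c < leaves t → leaves t < (c + c) + (c + c) →
  All (HasLeaves (c + c)) ts → Stage (c + c) (insertT t ts)
insert-middle [] 2c< <4c [] = middle∷ 2c< <4c []
insert-middle {c} {t} (s ∷ ss) 2c< <4c (ls ∷ all) with leaves t ≤ᵇ leaves s in le
... | true  = ⊥-elim (<⇒≱ 2c< (subst (leaves t ≤_) ls (≤ᵇ≡true⇒≤ le)))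
... | false = small∷ ls (insert-middle {c} ss 2c< <4c all)

all-small : ∀ {c} ts → All (HasLeaves c) ts → Stage c ts
all-small []       []         = doubled []
all-small (_ ∷ ts) (lt ∷ all) = small∷ lt (all-small ts all)

merge : ∀ {u v ts} → GfbForest (u ∷ v ∷ ts) → GfbForest (insertT (node u v) ts)
merge {ts = ts} (c , pc , small∷ lu (small∷ lv st)) =
  c , pc , insert-doubled ts (Pow2⇒1≤ pc) (cong₂ _+_ lu lv) st
merge {u} {v} {ts} (c , pc , small∷ lu (middle∷ c<v v<2c all)) =
  c + c , double pc , insert-middle {c} ts (+-mono-≤-< (≤-reflexive (sym lu)) c<v) (begin-strict
    leaves u + leaves v ≡⟨ cong (_+ leaves v) lu ⟩
    c + leaves v        <⟨ +-monoʳ-< c v<2c ⟩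
    c + (c + c)         ≤⟨ +-monoˡ-≤ (c + c) (m≤m+n c c) ⟩
    (c + c) + (c + c)   ∎) all
  where open ≤-Reasoning
merge {u} {v} {ts} (c , pc , small∷ lu (doubled (lv ∷ all))) =
  c + c , double pc , insert-middle {c} ts 2c<u+v (+-mono-<-≤ u<2c (≤-reflexive lv)) all
  where
  u<2c : leaves u < c + c
  u<2c = subst (_< c + c) (sym lu) (m<m+n c (Pow2⇒1≤ pc))
  2c<u+v : c + c < leaves u + leaves v
  2c<u+v = +-mono-≤-< (≤-reflexive (sym lu)) (<-≤-trans (m<m+n c (Pow2⇒1≤ pc)) (≤-reflexive (sym lv)))
merge {ts = ts} (c , pc , middle∷ c<u u<2c (lv ∷ all)) =
  c + c , double pc , insert-middle {c} ts (+-mono-<-≤ c<u (≤-trans (m≤m+n c c) (≤-reflexive (sym lv))))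
                                            (+-mono-<-≤ u<2c (≤-reflexive lv)) all
merge {ts = ts} (c , pc , doubled (lu ∷ lv ∷ all)) =
  c + c , double pc , insert-doubled ts (Pow2⇒1≤ (double pc)) (cong₂ _+_ lu lv) (all-small ts all)

final-window : ∀ {c u v} → Pow2 c → Stage c (u ∷ v ∷ []) → Window c (leaves u + leaves v)
final-window {c} pc (small∷ lu (small∷ lv (doubled []))) rewrite lu | lv =
  pc , ≤-refl , m≤m+n (c + c) (c + c)
final-window {c} pc (small∷ lu (middle∷ c<v v<2c [])) rewrite lu =
  pc , +-monoʳ-≤ c (<⇒≤ c<v) , <⇒≤ (<-≤-trans (+-monoʳ-< c v<2c) (+-monoˡ-≤ (c + c) (m≤m+n c c)))
final-window {c} pc (small∷ lu (doubled (lv ∷ []))) rewrite lu | lv =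
  pc , m≤n+m (c + c) c , +-monoˡ-≤ (c + c) (m≤m+n c c)
final-window {c} {u} pc (middle∷ c<u u<2c (lv ∷ [])) rewrite lv =
  pc , m≤n+m (c + c) (leaves u) , +-monoˡ-≤ (c + c) (<⇒≤ u<2c)
final-window {c} pc (doubled (lu ∷ lv ∷ [])) rewrite lu | lv =
  pc , m≤m+n (c + c) (c + c) , ≤-refl

final-exceeds : ∀ {c u v a} → Stage c (u ∷ v ∷ []) → leaves u ⊔ leaves v < a →
  ExceedsAt c (leaves u + leaves v) a
final-exceeds {c} (small∷ lu (small∷ lv (doubled []))) h rewrite lu | lv =
  inj₁ (+-monoˡ-< c (subst (_< _) (⊔-idem c) h))
final-exceeds {c} {v = v} {a} (small∷ lu (middle∷ _ _ [])) h rewrite lu =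
  inj₁ (subst (_< a + c) (+-comm (leaves v) c) (+-monoˡ-< c (m⊔n<o⇒n<o c (leaves v) h)))
final-exceeds (small∷ _ (doubled (lv ∷ []))) h rewrite lv = inj₂ (m⊔n<o⇒n<o _ _ h)
final-exceeds (middle∷ _ _ (lv ∷ [])) h rewrite lv          = inj₂ (m⊔n<o⇒n<o _ _ h)
final-exceeds (doubled (_ ∷ lv ∷ [])) h rewrite lv          = inj₂ (m⊔n<o⇒n<o _ _ h)

totalLeaves : List Tree → ℕ
totalLeaves []       = 0
totalLeaves (t ∷ ts) = leaves t + totalLeaves ts

totalLeaves-insertT : ∀ t ts → totalLeaves (insertT t ts) ≡ leaves t + totalLeaves ts
totalLeaves-insertT t [] = refl
totalLeaves-insertT t (s ∷ ss) with leaves t ≤ᵇ leaves s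
... | true  = refl
... | false =
  trans (cong (leaves s +_) (totalLeaves-insertT t ss)) (+-left-comm (leaves s) (leaves t) _)
  where
  +-left-comm : ∀ x y z → x + (y + z) ≡ y + (x + z)
  +-left-comm = solve-∀

length-insertT : ∀ t ts → length (insertT t ts) ≡ suc (length ts)
length-insertT t [] = refl
length-insertT t (s ∷ ss) with leaves t ≤ᵇ leaves s
... | true  = refl
... | false = cong suc (length-insertT t ss)

GfbRootSplit : ℕ → Tree → Set
GfbRootSplit n t = rootB t + rootA t ≡ n × (∀ {a} → rootA t < a → ExceedsGfbSplit n a)

gfbLoop-rootSplit : ∀ k ts → GfbForest ts → 2 ≤ length ts → length ts ≤ suc k →
  GfbRootSplit (totalLeaves ts) (gfbLoop k ts)
gfbLoop-rootSplit _ [] _ () _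
gfbLoop-rootSplit _ (_ ∷ []) _ (s≤s ()) _
gfbLoop-rootSplit zero (_ ∷ _ ∷ _) _ _ (s≤s ())
gfbLoop-rootSplit (suc k) (u ∷ v ∷ []) (c , pc , st) _ _ =
  subst (λ n → GfbRootSplit n (node u v)) (cong (leaves u +_) (sym (+-identityʳ (leaves v))))
    (m⊓n+m⊔n≡m+n (leaves u) (leaves v) , λ h → c , final-window pc st , final-exceeds st h)
gfbLoop-rootSplit (suc k) (u ∷ v ∷ ts@(_ ∷ _)) F _ (s≤s 1+ts≤1+k) =
  subst (λ n → GfbRootSplit n (gfbLoop k merged)) total≡
    (gfbLoop-rootSplit k merged (merge F) 2≤merged merged≤1+k)
  where
  merged : List Tree
  merged = insertT (node u v) ts
  total≡ : totalLeaves merged ≡ totalLeaves (u ∷ v ∷ ts)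
  total≡ = trans (totalLeaves-insertT (node u v) ts) (+-assoc (leaves u) (leaves v) _)
  2≤merged : 2 ≤ length merged
  2≤merged = subst (2 ≤_) (sym (length-insertT (node u v) ts)) (s≤s (s≤s z≤n))
  merged≤1+k : length merged ≤ suc k
  merged≤1+k = subst (_≤ suc k) (sym (length-insertT (node u v) ts)) 1+ts≤1+k

gfb-rootSplit : ∀ {n} → 2 ≤ n → GfbRootSplit n (gfb n)
gfb-rootSplit {n} 2≤n = subst (λ m → GfbRootSplit m (gfb n)) (totalLeaves-replicate n)
  (gfbLoop-rootSplit n (replicate n leaf) (1 , one , all-small _ (all-leaf n))
    (subst (2 ≤_) (sym (length-replicate n)) 2≤n)
    (subst (_≤ suc n) (sym (length-replicate n)) (n≤1+n n)))
  where
  all-leaf : ∀ n → All (HasLeaves 1) (replicate n leaf)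
  all-leaf zero    = []
  all-leaf (suc n) = refl ∷ all-leaf n
  totalLeaves-replicate : ∀ n → totalLeaves (replicate n leaf) ≡ n
  totalLeaves-replicate zero    = refl
  totalLeaves-replicate (suc n) = cong suc (totalLeaves-replicate n)

GfbRootSplit-rootB : ∀ {a b t} → GfbRootSplit (a + b) t → a ≤ rootA t → rootB t ≤ b
GfbRootSplit-rootB {a} {b} {t} (sum≡ , _) a≤A = +-cancelʳ-≤ a (rootB t) b (begin
  rootB t + a       ≤⟨ +-monoʳ-≤ (rootB t) a≤A ⟩
  rootB t + rootA t ≡⟨ sum≡ ⟩
  a + b             ≡⟨ +-comm a b ⟩
  b + a             ∎)
  where open ≤-Reasoning

minColless-root : ∀ Ta Tb → 2 ≤ leaves Ta + leaves Tb → MinColless (node Ta Tb) →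
  ∣ leaves Ta - leaves Tb ∣ + cmb (leaves Ta) + cmb (leaves Tb) ≤ cmb (leaves Ta + leaves Tb)
minColless-root Ta Tb 2≤n minimal =
  ≤-trans (+-mono-≤ (+-monoʳ-≤ ∣ leaves Ta - leaves Tb ∣ (cmb-minimal Ta)) (cmb-minimal Tb))
          (minimal (mb (leaves Ta + leaves Tb)) (leaves-mb _ (≤-trans (s≤s z≤n) 2≤n)))

corollary2 : (n : ℕ) → 2 ≤ n → (Ta Tb : Tree) → leaves Tb ≤ leaves Ta →
    leaves (node Ta Tb) ≡ n → MinColless (node Ta Tb) →
    (leaves Ta ≤ rootA (gfb n) × rootA (mb n) ≤ leaves Ta) ×
    (rootB (gfb n) ≤ leaves Tb × leaves Tb ≤ rootB (mb n))
corollary2 _ 2≤n Ta Tb nb≤na refl minimal =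
  (na≤gfbA , mbA≤na) , (GfbRootSplit-rootB {t = gfb (na + nb)} (gfb-rootSplit 2≤n) na≤gfbA , nb≤mbB)
  where
  na nb : ℕ
  na = leaves Ta
  nb = leaves Tb
  na≤gfbA : na ≤ rootA (gfb (na + nb))
  na≤gfbA = ≮⇒≥ λ gfbA<na →
    <⇒≱ (proj₂ (split-bound (1≤leaves Tb) nb≤na) (proj₂ (gfb-rootSplit 2≤n) gfbA<na))
        (minColless-root Ta Tb 2≤n minimal)
  mbA≤na : rootA (mb (na + nb)) ≤ na
  mbA≤na = subst (_≤ na) (sym (mb-rootA (na + nb) 2≤n)) (⌈m+n/2⌉≤m nb≤na)
  nb≤mbB : nb ≤ rootB (mb (na + nb))
  nb≤mbB = subst (nb ≤_) (sym (mb-rootB (na + nb) 2≤n)) (n≤⌊m+n/2⌋ nb≤na)
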